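{- Let $\Delta\ge1$. Suppose the current graph is a forest (arboricity 1) with a $\Delta$-orientation, and an edge is inserted such that the graph remains a forest and, with its orientation, some vertex $r$ has outdegree $\Delta+1$ (all other vertices having outdegree at most $\Delta$). Then during the ensuing reset cascade of the Brodal–Fagerberg algorithm (with resets performed in any order), no vertex ever has outdegree greater than $\Delta+1$.
   Context: A $\Delta$-orientation is an orientation of the edges in which every vertex has outdegree at most $\Delta$. Resetting a vertex means flipping all its outgoing edges so that they become incoming to it. The Brodal–Fagerberg (BF) algorithm with threshold $\Delta$: an edge deletion simply removes the edge; an inserted edge is oriented (arbitrarily); then, as long as some vertex has outdegree greater than $\Delta$, an arbitrary such vertex is reset (this sequence of resets is the reset cascade). -}

module Defs where

open import Data.Nat using (ℕ; suc; _≤_; _>_)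
open import Data.Fin using (Fin; _≟_)
open import Data.Product using (_×_; _,_; proj₁; proj₂)
open import Data.Sum using (_⊎_)
open import Data.List using (List; []; _∷_; length; filter; map; _++_; [_])
open import Data.List.Membership.Propositional using (_∈_)
open import Data.List.Relation.Unary.Unique.Propositional using (Unique)
open import Data.List.Relation.Unary.AllPairs using (AllPairs)
open import Data.List.Relation.Unary.Linked using (Linked)
open import Relation.Binary.PropositionalEquality using (_≡_)
open import Relation.Binary.Construct.Closure.ReflexiveTransitive using (Star)
open import Relation.Nullary using (¬_; yes; no)

-- An oriented (multi)graph on vertex set Fin n: a list of arcs (tail , head),
-- i.e. the edge {tail,head} oriented from tail to head.
Arc : ℕ → Set
Arc n = Fin n × Fin n

Oriented : ℕ → Set
Oriented n = List (Arc n)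

outdeg : ∀ {n} → Oriented n → Fin n → ℕ
outdeg G v = length (filter (λ e → proj₁ e ≟ v) G)

IsΔOrientation : ∀ {n} → ℕ → Oriented n → Set
IsΔOrientation Δ G = ∀ v → outdeg G v ≤ Δ

SameEdge : ∀ {n} → Arc n → Arc n → Set
SameEdge (a , b) (c , d) = ((a ≡ c) × (b ≡ d)) ⊎ ((a ≡ d) × (b ≡ c))

Adj : ∀ {n} → Oriented n → Fin n → Fin n → Set
Adj G u v = ((u , v) ∈ G) ⊎ ((v , u) ∈ G)

Simple : ∀ {n} → Oriented n → Set
Simple {n} G = (∀ (v : Fin n) → ¬ ((v , v) ∈ G)) × AllPairs (λ e f → ¬ SameEdge e f) G

IsCycle : ∀ {n} → Oriented n → Fin n → List (Fin n) → Set
IsCycle G x xs = (2 ≤ length xs) × Unique (x ∷ xs) × Linked (Adj G) (x ∷ xs ++ [ x ])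

Forest : ∀ {n} → Oriented n → Set
Forest G = Simple G × (∀ x xs → ¬ IsCycle G x xs)

flipAt : ∀ {n} → Fin n → Arc n → Arc n
flipAt x (a , b) with a ≟ x
... | yes _ = (b , a)
... | no  _ = (a , b)

reset : ∀ {n} → Fin n → Oriented n → Oriented n
reset x G = map (flipAt x) G

data CascadeStep {n : ℕ} (Δ : ℕ) : Oriented n → Oriented n → Set where
  step : ∀ {G} x → outdeg G x > Δ → CascadeStep Δ G (reset x G)

Cascade : ∀ {n} → ℕ → Oriented n → Oriented n → Set
Cascade Δ = Star (CascadeStep Δ)

module Submission where

open import Defs
open import Data.Nat using (ℕ; suc; _≤_; _+_; z≤n; s≤s)
open import Data.Nat.Properties
  using (≤-trans; ≤-reflexive; +-suc; +-comm; +-identityʳ; +-mono-≤; +-monoˡ-≤; <⇒≱; m+1+n≰m;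
         module ≤-Reasoning)
open import Data.Fin using (Fin; _≟_)
open import Data.Product using (Σ; _×_; _,_; proj₁; proj₂)
open import Data.Product.Properties using (≡-dec)
open import Data.Sum using (_⊎_; inj₁; inj₂)
open import Data.Empty using (⊥; ⊥-elim)
open import Data.List using (List; []; _∷_; _++_; [_]; length; reverse; map; filter)
open import Data.List.Properties
  using (++-assoc; unfold-reverse; reverse-++; length-reverse; length-++; length-map)
open import Data.List.Membership.Propositional using (_∈_; _∉_)
open import Data.List.Membership.Propositional.Properties using (∈-∃++; ∈-map⁻; ∈-filter⁺)
open import Data.List.Relation.Unary.Any using (here; there; any?)
import Data.List.Relation.Unary.Any.Properties as Any
open import Data.List.Relation.Unary.All using (All; []; _∷_)
import Data.List.Relation.Unary.All as All
import Data.List.Relation.Unary.All.Properties as All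
open import Data.List.Relation.Unary.AllPairs using (AllPairs; []; _∷_)
import Data.List.Relation.Unary.AllPairs as AllPairs
import Data.List.Relation.Unary.AllPairs.Properties as AllPairs
open import Data.List.Relation.Unary.Unique.Propositional using (Unique)
import Data.List.Relation.Unary.Unique.Propositional.Properties as Unique
open import Data.List.Relation.Unary.Linked using (Linked; []; [-]; _∷_)
import Data.List.Relation.Unary.Linked as Linked
open import Relation.Binary.Definitions using (DecidableEquality)
open import Relation.Binary.PropositionalEquality
  using (_≡_; _≢_; refl; sym; trans; cong; subst; module ≡-Reasoning)
open import Relation.Binary.Construct.Closure.ReflexiveTransitive using (ε; _◅_)
open import Relation.Nullary using (¬_; Dec; yes; no)

-- Call a vertex u of an orientation H *tight* if outdeg u plus the number of
-- distinct tight in-neighbours of u is at least Δ+1 (least such predicate): a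
-- vertex that must be reset is tight, and tightness spreads along arcs. The
-- invariant Inv H says that outdeg w plus the number of distinct tight
-- in-neighbours of w never exceeds Δ+1; with no in-neighbours this is the bound
-- we want.
-- The theorem combines the two; it does not even need Δ ≥ 1 or the previous
-- Δ-orientation.

module _ {A : Set} where

  linked-upto : ∀ {R : A → A → Set} xs {c ys} → Linked R (xs ++ c ∷ ys) → Linked R (xs ++ [ c ])
  linked-upto []           _       = [-]
  linked-upto (x ∷ [])     (r ∷ _) = r ∷ [-]
  linked-upto (x ∷ y ∷ xs) (r ∷ l) = r ∷ linked-upto (y ∷ xs) l

  linked-suffix : ∀ {R : A → A → Set} xs {ys} → Linked R (xs ++ ys) → Linked R ys
  linked-suffix []       l = l
  linked-suffix (x ∷ xs) l = linked-suffix xs (Linked.tail l)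

  linked-join : ∀ {R : A → A → Set} xs {c ys} →
                Linked R (xs ++ [ c ]) → Linked R (c ∷ ys) → Linked R (xs ++ c ∷ ys)
  linked-join []           _            l = l
  linked-join (x ∷ [])     (r ∷ [-])    l = r ∷ l
  linked-join (x ∷ y ∷ xs) (r ∷ prefix) l = r ∷ linked-join (y ∷ xs) prefix l

  linked-reverse : ∀ {R : A → A → Set} → (∀ {a b} → R a b → R b a) →
                   ∀ {xs} → Linked R xs → Linked R (reverse xs)
  linked-reverse sym-R []  = []
  linked-reverse sym-R [-] = [-]
  linked-reverse {R} sym-R {x ∷ y ∷ ys} (r ∷ l) =
    subst (Linked R) (sym reverse-xyys) (linked-join (reverse ys) reversed-tail (sym-R r ∷ [-]))
    where
    open ≡-Reasoning
    reverse-xyys : reverse (x ∷ y ∷ ys) ≡ reverse ys ++ y ∷ [ x ]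
    reverse-xyys = begin
      reverse (x ∷ y ∷ ys)           ≡⟨ unfold-reverse x (y ∷ ys) ⟩
      reverse (y ∷ ys) ++ [ x ]      ≡⟨ cong (_++ [ x ]) (unfold-reverse y ys) ⟩
      (reverse ys ++ [ y ]) ++ [ x ] ≡⟨ ++-assoc (reverse ys) [ y ] [ x ] ⟩
      reverse ys ++ y ∷ [ x ]        ∎
    reversed-tail : Linked R (reverse ys ++ [ y ])
    reversed-tail = subst (Linked R) (unfold-reverse y ys) (linked-reverse sym-R l)

  allPairs-prefix : ∀ {R : A → A → Set} xs {ys} → AllPairs R (xs ++ ys) → AllPairs R xs
  allPairs-prefix []       _        = []
  allPairs-prefix (x ∷ xs) (px ∷ p) = All.++⁻ˡ xs px ∷ allPairs-prefix xs p

  allPairs-upto : ∀ {R : A → A → Set} xs {c ys} → AllPairs R (xs ++ c ∷ ys) → AllPairs R (xs ++ [ c ])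
  allPairs-upto {R} xs {c} {ys} p =
    allPairs-prefix (xs ++ [ c ]) (subst (AllPairs R) (sym (++-assoc xs [ c ] ys)) p)

  allPairs-suffix : ∀ {R : A → A → Set} xs {ys} → AllPairs R (xs ++ ys) → AllPairs R ys
  allPairs-suffix []       p       = p
  allPairs-suffix (x ∷ xs) (_ ∷ p) = allPairs-suffix xs p

  allPairs-lookup : ∀ {R : A → A → Set} {xs a b} → AllPairs R xs → a ∈ xs → b ∈ xs → a ≢ b →
                    R a b ⊎ R b a
  allPairs-lookup (_ ∷ _)  (here refl) (here refl) a≢b = ⊥-elim (a≢b refl)
  allPairs-lookup (px ∷ _) (here refl) (there b∈)  _   = inj₁ (All.lookup px b∈)
  allPairs-lookup (px ∷ _) (there a∈)  (here refl) _   = inj₂ (All.lookup px a∈)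
  allPairs-lookup (_ ∷ p)  (there a∈)  (there b∈)  a≢b = allPairs-lookup p a∈ b∈ a≢b

  unique-middle : ∀ xs {c : A} {ys} → Unique (xs ++ c ∷ ys) → c ∉ xs
  unique-middle (x ∷ xs) (px ∷ u) (here refl) with All.++⁻ʳ xs px
  ... | x≢x ∷ _ = x≢x refl
  unique-middle (x ∷ xs) (px ∷ u) (there c∈xs) = unique-middle xs u c∈xs

  unique-reverse : ∀ {xs : List A} → Unique xs → Unique (reverse xs)
  unique-reverse {[]}     _        = []
  unique-reverse {x ∷ xs} (px ∷ u) = subst Unique (sym (unfold-reverse x xs))
    (Unique.++⁺ (unique-reverse u) ([] ∷ [])
      λ { (x∈rev , here refl) → All.lookup px (Any.reverse⁻ x∈rev) refl })

  unique-length-≤ : ∀ {xs ys : List A} → Unique xs → (∀ {z} → z ∈ xs → z ∈ ys) →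
                    length xs ≤ length ys
  unique-length-≤ {[]}     _        _     = z≤n
  unique-length-≤ {x ∷ xs} (px ∷ u) xs⊆ys with ∈-∃++ (xs⊆ys (here refl))
  ... | B , D , refl = subst (_ ≤_) (sym length-split)
        (s≤s (unique-length-≤ u λ z∈xs →
          delete B (xs⊆ys (there z∈xs)) (λ z≡x → All.lookup px z∈xs (sym z≡x))))
    where
    delete : ∀ B {z D} → z ∈ B ++ x ∷ D → z ≢ x → z ∈ B ++ D
    delete []      (here z≡x)  z≢x = ⊥-elim (z≢x z≡x)
    delete []      (there z∈D) _   = z∈D
    delete (b ∷ B) (here z≡b)  _   = here z≡b
    delete (b ∷ B) (there z∈)  z≢x = there (delete B z∈ z≢x)
    length-split : length (B ++ x ∷ D) ≡ suc (length (B ++ D))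
    length-split = trans (length-++ B) (trans (+-suc (length B) (length D)) (cong suc (sym (length-++ B))))

  nonempty-length : ∀ xs {c : A} {ys} → 1 ≤ length (xs ++ c ∷ ys)
  nonempty-length []      = s≤s z≤n
  nonempty-length (_ ∷ _) = s≤s z≤n

  first-common : DecidableEquality A → ∀ (ps qs : List A) {z} → z ∈ ps → z ∈ qs →
    Σ (List A) λ B → Σ A λ c → Σ (List A) λ C → (ps ≡ B ++ c ∷ C) × c ∈ qs × All (_∉ qs) B
  first-common _≟A_ (p ∷ ps) qs z∈ z∈qs with any? (p ≟A_) qs
  ... | yes p∈qs = [] , p , ps , refl , p∈qs , []
  first-common _≟A_ (p ∷ ps) qs (here refl) z∈qs | no p∉qs = ⊥-elim (p∉qs z∈qs)
  first-common _≟A_ (p ∷ ps) qs (there z∈) z∈qs | no p∉qs with first-common _≟A_ ps qs z∈ z∈qs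
  ... | B , c , C , refl , c∈qs , B∉qs = p ∷ B , c , C , refl , c∈qs , p∉qs ∷ B∉qs

  data Last : List A → A → Set where
    last-one  : ∀ {x} → Last (x ∷ []) x
    last-cons : ∀ {x y xs} → Last xs x → Last (y ∷ xs) x

  last-∈ : ∀ {xs x} → Last xs x → x ∈ xs
  last-∈ last-one      = here refl
  last-∈ (last-cons l) = there (last-∈ l)

  last-suffix : ∀ xs {c : A} {ys x} → Last (xs ++ c ∷ ys) x → Last (c ∷ ys) x
  last-suffix []           l             = l
  last-suffix (y ∷ [])     (last-cons l) = l
  last-suffix (y ∷ z ∷ xs) (last-cons l) = last-suffix (z ∷ xs) l

module _ {n : ℕ} where

  outdeg-other : ∀ {v : Fin n} (e : Arc n) H → proj₁ e ≢ v → outdeg (e ∷ H) v ≡ outdeg H v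
  outdeg-other {v} (a , b) H a≢v with a ≟ v
  ... | yes a≡v = ⊥-elim (a≢v a≡v)
  ... | no  _   = refl

  out-neighbours-≤-outdeg : ∀ (H : Oriented n) x {vs} → Unique vs → All (λ v → (x , v) ∈ H) vs →
                            length vs ≤ outdeg H x
  out-neighbours-≤-outdeg H x {vs} uq arcs = subst (_≤ outdeg H x) (length-map (x ,_) vs)
    (unique-length-≤ (Unique.map⁺ (λ { refl → refl }) uq) out-arc)
    where
    out-arc : ∀ {e} → e ∈ map (x ,_) vs → e ∈ filter (λ e → proj₁ e ≟ x) H
    out-arc m with ∈-map⁻ (x ,_) m
    ... | v , v∈vs , refl = ∈-filter⁺ (λ e → proj₁ e ≟ x) (All.lookup arcs v∈vs) refl

  _∈?_ : (e : Arc n) (H : Oriented n) → Dec (e ∈ H)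
  e ∈? H = any? (≡-dec _≟_ _≟_ e) H

  ∈-reset⁻ : ∀ {x v u : Fin n} {H} → (v , u) ∈ reset x H →
             ((v , u) ∈ H × v ≢ x) ⊎ ((u , v) ∈ H × u ≡ x)
  ∈-reset⁻ {x} m with ∈-map⁻ (flipAt x) m
  ... | (a , b) , ab∈H , eq with a ≟ x | eq
  ...   | yes a≡x | refl = inj₂ (ab∈H , a≡x)
  ...   | no  a≢x | refl = inj₁ (ab∈H , a≢x)

  reset-outdeg-self : ∀ (x : Fin n) H → (∀ v → (v , v) ∉ H) → outdeg (reset x H) x ≡ 0
  reset-outdeg-self x [] _ = refl
  reset-outdeg-self x ((a , b) ∷ H) loopless with a ≟ x
  ... | yes refl = trans (outdeg-other (b , a) (reset a H) λ { refl → loopless a (here refl) })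
                         (reset-outdeg-self a H (λ v m → loopless v (there m)))
  ... | no  a≢x  = trans (outdeg-other (a , b) (reset x H) a≢x)
                         (reset-outdeg-self x H (λ v m → loopless v (there m)))

  reset-outdeg-unchanged : ∀ (x u : Fin n) H → u ≢ x → (x , u) ∉ H →
                           outdeg (reset x H) u ≡ outdeg H u
  reset-outdeg-unchanged x u [] _ _ = refl
  reset-outdeg-unchanged x u ((a , b) ∷ H) u≢x xu∉ with a ≟ x
  ... | yes refl with b ≟ u
  ...   | yes refl = ⊥-elim (xu∉ (here refl))
  ...   | no  _    = trans (reset-outdeg-unchanged a u H u≢x (λ m → xu∉ (there m)))
                           (sym (outdeg-other (a , b) H λ { refl → u≢x refl }))
  reset-outdeg-unchanged x u ((a , b) ∷ H) u≢x xu∉ | no a≢x with a ≟ u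
  ...   | yes refl = cong suc (reset-outdeg-unchanged x a H u≢x (λ m → xu∉ (there m)))
  ...   | no  _    = reset-outdeg-unchanged x u H u≢x (λ m → xu∉ (there m))

  -- Without parallel edges a vertex u ≠ x gains at most one out-arc when x is
  -- reset (the flipped edge xu, if present).
  reset-outdeg-≤ : ∀ (x u : Fin n) H → u ≢ x → AllPairs (λ e f → ¬ SameEdge e f) H →
                   outdeg (reset x H) u ≤ suc (outdeg H u)
  reset-outdeg-≤ x u [] _ _ = z≤n
  reset-outdeg-≤ x u ((a , b) ∷ H) u≢x (px ∷ p) with a ≟ x
  ... | yes refl with b ≟ u
  ...   | yes refl = s≤s (≤-reflexive (trans
                       (reset-outdeg-unchanged a b H u≢x (λ m → All.lookup px m (inj₁ (refl , refl))))
                       (sym (outdeg-other (a , b) H λ { refl → u≢x refl }))))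
  ...   | no  _    = subst (outdeg (reset a H) u ≤_)
                       (cong suc (sym (outdeg-other (a , b) H λ { refl → u≢x refl })))
                       (reset-outdeg-≤ a u H u≢x p)
  reset-outdeg-≤ x u ((a , b) ∷ H) u≢x (px ∷ p) | no a≢x with a ≟ u
  ...   | yes refl = s≤s (reset-outdeg-≤ x a H u≢x p)
  ...   | no  _    = reset-outdeg-≤ x u H u≢x p

  SameEdge-sym : ∀ {e f : Arc n} → SameEdge e f → SameEdge f e
  SameEdge-sym (inj₁ (p , q)) = inj₁ (sym p , sym q)
  SameEdge-sym (inj₂ (p , q)) = inj₂ (sym q , sym p)

  SameEdge-flipAt : ∀ (x : Fin n) e f → SameEdge (flipAt x e) f → SameEdge e f
  SameEdge-flipAt x (a , b) f same with a ≟ x | same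
  ... | no  _ | same′            = same′
  ... | yes _ | inj₁ (b≡c , a≡d) = inj₂ (a≡d , b≡c)
  ... | yes _ | inj₂ (b≡d , a≡c) = inj₁ (a≡c , b≡d)

  reset-simple : ∀ (x : Fin n) {H} → Simple H → Simple (reset x H)
  reset-simple x {H} (loopless , no-parallel) = loopless′ ,
    AllPairs.map⁺ (AllPairs.map (λ distinct same →
      distinct (SameEdge-sym (SameEdge-flipAt x _ _ (SameEdge-sym (SameEdge-flipAt x _ _ same)))))
      no-parallel)
    where
    loopless′ : ∀ v → (v , v) ∉ reset x H
    loopless′ v m with ∈-reset⁻ m
    ... | inj₁ (vv∈H , _) = loopless v vv∈H
    ... | inj₂ (vv∈H , _) = loopless v vv∈H

-- Into K a b: the arc b → a is present, i.e. b is an in-neighbour of a.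
-- A list linked by Into K is a directed path written from its end backwards.
Into : ∀ {n} → Oriented n → Fin n → Fin n → Set
Into K a b = (b , a) ∈ K

module _ {n : ℕ} {K : Oriented n} where

  Adj-sym : ∀ {a b} → Adj K a b → Adj K b a
  Adj-sym (inj₁ ab∈K) = inj₂ ab∈K
  Adj-sym (inj₂ ba∈K) = inj₁ ba∈K

  no-2-cycle : Simple K → ∀ {a b} → (a , b) ∈ K → (b , a) ∈ K → ⊥
  no-2-cycle (loopless , no-parallel) {a} {b} ab∈K ba∈K with a ≟ b
  ... | yes refl = loopless a ab∈K
  ... | no  a≢b with allPairs-lookup no-parallel ab∈K ba∈K (λ eq → a≢b (cong proj₁ eq))
  ...   | inj₁ distinct = distinct (inj₂ (refl , refl))
  ...   | inj₂ distinct = distinct (inj₂ (refl , refl))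

  -- Two simple paths from w that end at c and are otherwise disjoint form a cycle
  -- through w: out along the first, back along the second.
  glue-cycle : ∀ {w c} B B₂ → 2 ≤ length (B ++ c ∷ reverse B₂) →
               Unique (w ∷ B ++ [ c ]) → Unique (w ∷ B₂ ++ [ c ]) →
               (∀ {z} → z ∈ B → z ∉ B₂) →
               Linked (Adj K) (w ∷ B ++ [ c ]) → Linked (Adj K) (w ∷ B₂ ++ [ c ]) →
               IsCycle K w (B ++ c ∷ reverse B₂)
  glue-cycle {w} {c} B B₂ long u₁ (w∉B₂c ∷ uB₂c) disjoint l₁ l₂ = long , unique , linked
    where
    w∉B₂ : w ∉ B₂
    w∉B₂ w∈B₂ = All.lookup w∉B₂c (Any.++⁺ˡ w∈B₂) refl
    apart : ∀ {z} → z ∈ w ∷ B ++ [ c ] → z ∉ reverse B₂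
    apart (here refl) z∈ = w∉B₂ (Any.reverse⁻ z∈)
    apart (there z∈B[c]) z∈ with Any.++⁻ B z∈B[c]
    ... | inj₁ z∈B         = disjoint z∈B (Any.reverse⁻ z∈)
    ... | inj₂ (here refl) = unique-middle B₂ uB₂c (Any.reverse⁻ z∈)
    unique : Unique (w ∷ B ++ c ∷ reverse B₂)
    unique = subst Unique (++-assoc (w ∷ B) [ c ] (reverse B₂))
      (Unique.++⁺ u₁ (unique-reverse (allPairs-prefix B₂ uB₂c)) λ (z∈ , z∈′) → apart z∈ z∈′)
    back : Linked (Adj K) (c ∷ reverse B₂ ++ [ w ])
    back = subst (Linked (Adj K))
      (trans (unfold-reverse w (B₂ ++ [ c ])) (cong (_++ [ w ]) (reverse-++ B₂ [ c ])))
      (linked-reverse Adj-sym l₂)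
    linked : Linked (Adj K) (w ∷ (B ++ c ∷ reverse B₂) ++ [ w ])
    linked = subst (λ cyc → Linked (Adj K) (w ∷ cyc)) (sym (++-assoc B (c ∷ reverse B₂) [ w ]))
      (linked-join (w ∷ B) l₁ back)

  no-closing-arc : Forest K → ∀ {v w ps} → Unique (v ∷ ps) → Linked (Into K) (v ∷ ps) →
                   w ∈ v ∷ ps → (v , w) ∈ K → ⊥
  no-closing-arc ((loopless , _) , _) {v} _ _ w∈ vw∈K with ∈-∃++ w∈
  ... | [] , D , refl = loopless v vw∈K
  no-closing-arc (simple , _) {v} _ lk _ vw∈K | _ ∷ [] , D , refl =
    no-2-cycle simple vw∈K (Linked.head lk)
  no-closing-arc (_ , acyclic) {v} {w} uq lk _ vw∈K | _ ∷ b ∷ B , D , refl =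
    acyclic v (b ∷ B ++ [ w ]) (s≤s (nonempty-length B) , allPairs-upto (v ∷ b ∷ B) uq , closed)
    where
    closed : Linked (Adj K) (v ∷ (b ∷ B ++ [ w ]) ++ [ v ])
    closed = subst (λ cyc → Linked (Adj K) (v ∷ b ∷ cyc)) (sym (++-assoc B [ w ] [ v ]))
      (linked-join (v ∷ b ∷ B) (Linked.map inj₂ (linked-upto (v ∷ b ∷ B) lk)) (inj₂ vw∈K ∷ [-]))

  paths-never-meet : Forest K → ∀ {w v₁ v₂ p₁ p₂ z} →
    Unique (w ∷ v₁ ∷ p₁) → Unique (w ∷ v₂ ∷ p₂) →
    Linked (Adj K) (w ∷ v₁ ∷ p₁) → Linked (Adj K) (w ∷ v₂ ∷ p₂) →
    v₁ ≢ v₂ → z ∈ v₁ ∷ p₁ → z ∈ v₂ ∷ p₂ → ⊥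
  paths-never-meet (_ , acyclic) {w} {v₁} {v₂} {p₁} {p₂} u₁ u₂ l₁ l₂ v₁≢v₂ z∈₁ z∈₂
    with first-common _≟_ (v₁ ∷ p₁) (v₂ ∷ p₂) z∈₁ z∈₂
  ... | B , c , C , path₁ , c∈₂ , B∉₂ with ∈-∃++ c∈₂
  ... | B₂ , D , path₂ = acyclic w (B ++ c ∷ reverse B₂)
        (glue-cycle B B₂ (long B B₂ path₁ path₂)
          (allPairs-upto (w ∷ B) (along path₁ Unique u₁))
          (allPairs-upto (w ∷ B₂) (along path₂ Unique u₂))
          disjoint
          (linked-upto (w ∷ B) (along path₁ (Linked (Adj K)) l₁))
          (linked-upto (w ∷ B₂) (along path₂ (Linked (Adj K)) l₂)))
    where
    along : ∀ {ps qs} → ps ≡ qs → (P : List (Fin n) → Set) → P (w ∷ ps) → P (w ∷ qs)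
    along eq P = subst (λ ps → P (w ∷ ps)) eq
    disjoint : ∀ {z} → z ∈ B → z ∉ B₂
    disjoint z∈B z∈B₂ = All.lookup B∉₂ z∈B (subst (_ ∈_) (sym path₂) (Any.++⁺ˡ z∈B₂))
    -- the cycle has at least two vertices besides w, because v₁ ≢ v₂
    long : ∀ B B₂ → v₁ ∷ p₁ ≡ B ++ c ∷ C → v₂ ∷ p₂ ≡ B₂ ++ c ∷ D →
           2 ≤ length (B ++ c ∷ reverse B₂)
    long []      []       refl refl = ⊥-elim (v₁≢v₂ refl)
    long []      (b ∷ B₂) _    _    = s≤s (subst (1 ≤_) (sym (length-reverse (b ∷ B₂))) (s≤s z≤n))
    long (_ ∷ B) _        _    _    = s≤s (nonempty-length B)

module Tightness {n : ℕ} (Δ : ℕ) where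

  data Tight (H : Oriented n) : Fin n → Set

  TightIns : Oriented n → Fin n → List (Fin n) → Set
  TightIns H w vs = Unique vs × All (λ v → (v , w) ∈ H × Tight H v) vs

  data Tight H where
    tight : ∀ {u} vs → TightIns H u vs → suc Δ ≤ outdeg H u + length vs → Tight H u

  Inv : Oriented n → Set
  Inv H = ∀ w vs → TightIns H w vs → outdeg H w + length vs ≤ suc Δ

  inv-bound : ∀ {H} → Inv H → ∀ w → outdeg H w ≤ suc Δ
  inv-bound inv w = subst (_≤ suc Δ) (+-identityʳ _) (inv w [] ([] , []))

  module AfterReset (H : Oriented n) (x : Fin n) (simple : Simple H)
                    (overfull : suc Δ ≤ outdeg H x) (inv : Inv H) where

    private
      H′ = reset x H

    x-tight : Tight H x
    x-tight = tight [] ([] , []) (subst (suc Δ ≤_) (sym (+-identityʳ _)) overfull)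

    x-sink : ∀ {u} → (x , u) ∉ H′
    x-sink m with ∈-reset⁻ m
    ... | inj₁ (_ , x≢x)     = x≢x refl
    ... | inj₂ (ux∈H , refl) = proj₁ simple x ux∈H

    tail-≢ : ∀ {v u} → (v , u) ∈ H′ → v ≢ x
    tail-≢ m refl = x-sink m

    arc-into : ∀ {v u} → u ≢ x → (v , u) ∈ H′ → (v , u) ∈ H
    arc-into u≢x m with ∈-reset⁻ m
    ... | inj₁ (vu∈H , _) = vu∈H
    ... | inj₂ (_ , u≡x)  = ⊥-elim (u≢x u≡x)

    -- Tightness of vertices u ≠ x, and their tight in-neighbour lists, pull back
    -- to H: if u gained the flipped arc ux, then x joins the list in H.
    tight-before : ∀ {u} → u ≢ x → Tight H′ u → Tight H u
    lift-ins : ∀ {u vs} → u ≢ x → TightIns H′ u vs →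
               Σ (List (Fin n)) λ vs′ →
                 TightIns H u vs′ × outdeg H′ u + length vs ≤ outdeg H u + length vs′
    lift-all : ∀ {u vs} → u ≢ x → All (λ v → (v , u) ∈ H′ × Tight H′ v) vs →
               All (λ v → (v , u) ∈ H × Tight H v) vs

    tight-before u≢x (tight vs ins bound) with lift-ins u≢x ins
    ... | vs′ , ins′ , le = tight vs′ ins′ (≤-trans bound le)

    lift-ins {u} {vs} u≢x (uq , ins) with (x , u) ∈? H
    ... | yes xu∈H = x ∷ vs , (x∉vs ∷ uq , (xu∈H , x-tight) ∷ lift-all u≢x ins) , gain-one
      where
      x∉vs : All (x ≢_) vs
      x∉vs = All.map (λ { (vu∈ , _) x≡v → tail-≢ vu∈ (sym x≡v) }) ins
      gain-one : outdeg H′ u + length vs ≤ outdeg H u + suc (length vs)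
      gain-one = ≤-trans (+-monoˡ-≤ (length vs) (reset-outdeg-≤ x u H u≢x (proj₂ simple)))
                         (≤-reflexive (sym (+-suc _ _)))
    ... | no  xu∉H = vs , (uq , lift-all u≢x ins) ,
                     ≤-reflexive (cong (_+ length vs) (reset-outdeg-unchanged x u H u≢x xu∉H))

    lift-all u≢x [] = []
    lift-all u≢x ((vu∈ , t) ∷ rest) =
      (arc-into u≢x vu∈ , tight-before (tail-≢ vu∈) t) ∷ lift-all u≢x rest

    -- A tight in-neighbour of x after the reset was an out-neighbour before:
    -- an old tight in-neighbour would give outdeg x + 1 ≤ Δ+1 in H.
    flipped-in : ∀ {v} → (v , x) ∈ H′ → Tight H′ v → (x , v) ∈ H
    flipped-in m t with ∈-reset⁻ m
    ... | inj₂ (xv∈H , _)   = xv∈H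
    ... | inj₁ (vx∈H , v≢x) = ⊥-elim (m+1+n≰m (outdeg H x)
            (≤-trans (inv x (_ ∷ []) ([] ∷ [] , (vx∈H , tight-before v≢x t) ∷ [])) overfull))

    inv-after : Inv H′
    inv-after w vs ins with w ≟ x
    ... | no w≢x with lift-ins w≢x ins
    ...   | vs′ , ins′ , le = ≤-trans le (inv w vs′ ins′)
    inv-after w vs (uq , ins) | yes refl = begin
      outdeg H′ x + length vs ≡⟨ cong (_+ length vs) (reset-outdeg-self x H (proj₁ simple)) ⟩
      length vs               ≤⟨ out-neighbours-≤-outdeg H x uq
                                   (All.map (λ (m , t) → flipped-in m t) ins) ⟩
      outdeg H x              ≤⟨ inv-bound inv x ⟩
      suc Δ                   ∎
      where open ≤-Reasoning

  cascade-invariant : ∀ {H H′} → Simple H → Inv H → Cascade Δ H H′ → Inv H′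
  cascade-invariant simple inv ε = inv
  cascade-invariant simple inv (step x overfull ◅ cascade) =
    cascade-invariant (reset-simple x simple) (AfterReset.inv-after _ x simple overfull inv) cascade

  module Insertion (K : Oriented n) (forest : Forest K) (r : Fin n)
                   (r-outdeg : outdeg K r ≡ suc Δ) (others : ∀ w → w ≢ r → outdeg K w ≤ Δ) where

    -- BackPath u ps: u ∷ ps is a simple directed path r → … → u, listed backwards.
    BackPath : Fin n → List (Fin n) → Set
    BackPath u ps = Unique (u ∷ ps) × Linked (Into K) (u ∷ ps) × Last (u ∷ ps) r

    -- Every tight vertex is reached from r: follow tight in-neighbours back to r,
    -- cutting the path short whenever it revisits u.
    tight⇒backPath : ∀ {u} → Tight K u → Σ (List (Fin n)) (BackPath u)
    tight⇒backPath {u} t with u ≟ r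
    ... | yes refl = [] , [] ∷ [] , [-] , last-one
    tight⇒backPath {u} (tight [] _ bound) | no u≢r =
      ⊥-elim (<⇒≱ (≤-trans bound (≤-reflexive (+-identityʳ _))) (others u u≢r))
    tight⇒backPath {u} (tight (v ∷ _) (_ , (vu∈K , tv) ∷ _) _) | no u≢r with tight⇒backPath tv
    ... | ps , uq , lk , last with any? (u ≟_) (v ∷ ps)
    ...   | no  u∉ = v ∷ ps , All.¬Any⇒All¬ _ u∉ ∷ uq , vu∈K ∷ lk , last-cons last
    ...   | yes u∈ with ∈-∃++ u∈
    ...     | B , D , split = D , allPairs-suffix B (subst Unique split uq) ,
                              linked-suffix B (subst (Linked (Into K)) split lk) ,
                              last-suffix B (subst (λ ps → Last ps r) split last)

    -- A tight in-neighbour v of w yields a simple path w, v, …, r (w is not on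
    -- the back path, else the arc vw would close a cycle).
    path-via : ∀ {v w} → (v , w) ∈ K → Tight K v →
               Σ (List (Fin n)) λ ps →
                 Unique (w ∷ v ∷ ps) × Linked (Adj K) (w ∷ v ∷ ps) × r ∈ v ∷ ps
    path-via {v} {w} vw∈K tv with tight⇒backPath tv
    ... | ps , uq , lk , last =
          ps , All.¬Any⇒All¬ _ (λ w∈ → no-closing-arc forest uq lk w∈ vw∈K) ∷ uq ,
          inj₂ vw∈K ∷ Linked.map inj₂ lk , last-∈ last

    -- r itself has no tight in-neighbour: the path back to r would revisit r.
    r-no-tight-in : ∀ {v} → (v , r) ∈ K → Tight K v → ⊥
    r-no-tight-in vr∈K tv with path-via vr∈K tv
    ... | _ , r∉ ∷ _ , _ , r∈ = All.lookup r∉ r∈ refl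

    -- Two tight in-neighbours of one vertex would give two paths to r.
    two-tight-ins : ∀ {v₁ v₂ w} → v₁ ≢ v₂ →
                    (v₁ , w) ∈ K → Tight K v₁ → (v₂ , w) ∈ K → Tight K v₂ → ⊥
    two-tight-ins v₁≢v₂ v₁w∈K t₁ v₂w∈K t₂ with path-via v₁w∈K t₁ | path-via v₂w∈K t₂
    ... | _ , u₁ , l₁ , r∈₁ | _ , u₂ , l₂ , r∈₂ =
          paths-never-meet forest u₁ u₂ l₁ l₂ v₁≢v₂ r∈₁ r∈₂

    at-most-one-tight-in : ∀ {w vs} → TightIns K w vs → length vs ≤ 1
    at-most-one-tight-in (_ , [])     = z≤n
    at-most-one-tight-in (_ , _ ∷ []) = s≤s z≤n
    at-most-one-tight-in ((v₁∉ ∷ _) , (v₁w∈K , t₁) ∷ (v₂w∈K , t₂) ∷ _) =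
      ⊥-elim (two-tight-ins (All.head v₁∉) v₁w∈K t₁ v₂w∈K t₂)

    -- Hence Inv holds: r has outdegree Δ+1 and no tight in-neighbour, every
    -- other vertex outdegree ≤ Δ and at most one tight in-neighbour.
    initial-inv : Inv K
    initial-inv w vs ins with w ≟ r
    initial-inv w []      _                     | yes refl = ≤-reflexive (trans (+-identityʳ _) r-outdeg)
    initial-inv w (_ ∷ _) (_ , (vr∈K , tv) ∷ _) | yes refl = ⊥-elim (r-no-tight-in vr∈K tv)
    ... | no w≢r = ≤-trans (+-mono-≤ (others w w≢r) (at-most-one-tight-in ins))
                           (≤-reflexive (+-comm Δ 1))

lemma2 : (n Δ : ℕ) → 1 ≤ Δ → (G : Oriented n) → Forest G → IsΔOrientation Δ G →
    (e : Arc n) → Forest (e ∷ G) →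
    (r : Fin n) → outdeg (e ∷ G) r ≡ suc Δ → (∀ w → w ≢ r → outdeg (e ∷ G) w ≤ Δ) →
    (H : Oriented n) → Cascade Δ (e ∷ G) H → ∀ w → outdeg H w ≤ suc Δ
lemma2 n Δ _ G _ _ e forest r r-outdeg others H cascade = inv-bound (cascade-invariant simple start cascade)
  where
  open Tightness {n} Δ
  simple : Simple (e ∷ G)
  simple = proj₁ forest
  start : Inv (e ∷ G)
  start = Insertion.initial-inv (e ∷ G) forest r r-outdeg others
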